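{- Let $\mathbb{F}$ be a field, $n,r,\ell\ge1$, and $\vec{A}=(A_0,\ldots,A_{r-1}),\vec{B}=(B_0,\ldots,B_{r-1})\in(\mathbb{F}^{n\times n})^r$. Define $A(x)=\sum_{i=0}^{r-1}A_ix^i$, $B(x)=\sum_{i=0}^{r-1}B_ix^i$, and for variables $x_1,\ldots,x_\ell$ let $f_\ell(\vec{A},\vec{x})=\tr(A(x_1)\cdots A(x_\ell))$ and $f_\ell(\vec{B},\vec{x})=\tr(B(x_1)\cdots B(x_\ell))$. Then $f_\ell(\vec{A},\vec{x})-f_\ell(\vec{B},\vec{x})$ is computed by a width $2n^2$, depth $\ell$, degree $<r$ ROABP in the variables $x_1,\ldots,x_\ell$ (in this order).
   Context: A read-once oblivious algebraic branching program (ROABP) of depth $d$, width $\le w$, degree $<r$ in variables $x_1,\ldots,x_d$ is a directed acyclic graph with vertex layers $V_0=\{s\},V_1,\ldots,V_d=\{t\}$, $\max_i|V_i|\le w$, all edges going from some $V_{i-1}$ to $V_i$, where each edge from $V_{i-1}$ to $V_i$ is labeled by a univariate polynomial in $x_i$ of degree $<r$; it computes the sum over all $s$-$t$ paths of the product of the edge labels. -}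

module Defs where

open import Level using (Level; _⊔_)
open import Algebra.Bundles using (CommutativeRing)
open import Data.Nat as ℕ using (ℕ; zero; suc; _≤_; _<_)
open import Data.Nat.Properties using (<⇒≤; ≤-refl)
open import Data.Fin using (Fin; zero; suc; _≟_; fromℕ<)
open import Data.Vec using (Vec; replicate; _[_]≔_)
open import Data.Vec.Properties using (≡-dec)
open import Data.List using (List; []; _∷_; _++_; map; concatMap; allFin; foldr)
open import Data.Product using (_×_; _,_; proj₁; proj₂; Σ)
open import Data.Maybe using (Maybe; just; nothing)
open import Relation.Nullary using (¬_; yes; no)
open import Relation.Binary.PropositionalEquality using (_≡_)

record Field (c ℓ : Level) : Set (Level.suc (c ⊔ ℓ)) where
  field
    commutativeRing : CommutativeRing c ℓ
  open CommutativeRing commutativeRing public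
  field
    0≉1     : ¬ (0# ≈ 1#)
    inverse : ∀ x → ¬ (x ≈ 0#) → Σ Carrier λ y → x * y ≈ 1#

module _ {c ℓ' : Level} (F : Field c ℓ') where
  open Field F using (Carrier; _≈_; _+_; _*_; -_; 0#; 1#)

  sumF : ∀ {m} → (Fin m → Carrier) → Carrier
  sumF {m} f = foldr (λ i acc → f i + acc) 0# (allFin m)

  -- A monomial is its exponent vector; a polynomial is a finite list of
  -- (coefficient, monomial) terms (i.e. a formal finite sum of terms).

  Monomial : ℕ → Set
  Monomial k = Vec ℕ k

  Poly : ℕ → Set c
  Poly k = List (Carrier × Monomial k)

  coeff : ∀ {k} → Poly k → Monomial k → Carrier
  coeff []             m = 0#
  coeff ((a , e) ∷ ps) m with ≡-dec ℕ._≟_ e m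
  ... | yes _ = a + coeff ps m
  ... | no  _ = coeff ps m

  _≈P_ : ∀ {k} → Poly k → Poly k → Set ℓ'
  p ≈P q = ∀ m → coeff p m ≈ coeff q m

  0P : ∀ {k} → Poly k
  0P = []

  constP : ∀ {k} → Carrier → Poly k
  constP a = (a , replicate _ 0) ∷ []

  1P : ∀ {k} → Poly k
  1P = constP 1#

  _+P_ : ∀ {k} → Poly k → Poly k → Poly k
  p +P q = p ++ q

  -P_ : ∀ {k} → Poly k → Poly k
  -P p = map (λ { (a , e) → (- a , e) }) p

  _-P_ : ∀ {k} → Poly k → Poly k → Poly k
  p -P q = p +P (-P q)

  addExp : ∀ {k} → Monomial k → Monomial k → Monomial k
  addExp = Data.Vec.zipWith ℕ._+_

  _*P_ : ∀ {k} → Poly k → Poly k → Poly k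
  p *P q = concatMap (λ { (a , e) → map (λ { (b , e') → (a * b , addExp e e') }) q }) p

  sumP : ∀ {k m} → (Fin m → Poly k) → Poly k
  sumP {m = m} f = foldr (λ i acc → f i +P acc) 0P (allFin m)

  varPow : ∀ {k} → Fin k → ℕ → Monomial k
  varPow {k} i d = replicate k 0 [ i ]≔ d

  univ : ∀ {k r} → Fin k → (Fin r → Carrier) → Poly k
  univ {r = r} i a = map (λ j → (a j , varPow i (Data.Fin.toℕ j))) (allFin r)

  Mat : ℕ → Set c
  Mat n = Fin n → Fin n → Carrier

  PMat : ℕ → ℕ → Set c
  PMat k n = Fin n → Fin n → Poly k

  _*M_ : ∀ {k n} → PMat k n → PMat k n → PMat k n
  (P *M Q) i j = sumP (λ t → P i t *P Q t j)

  idM : ∀ {k n} → PMat k n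
  idM i j with i ≟ j
  ... | yes _ = 1P
  ... | no  _ = 0P

  trace : ∀ {k n} → PMat k n → Poly k
  trace P = sumP (λ i → P i i)

  prodM : ∀ {k n m} → (Fin m → PMat k n) → PMat k n
  prodM {m = zero}  M = idM
  prodM {m = suc m} M = M zero *M prodM (λ i → M (suc i))

  matPolyAt : ∀ {k n r} → (Fin r → Mat n) → Fin k → PMat k n
  matPolyAt A i a b = univ i (λ j → A j a b)

  fTr : ∀ {n r} (ℓ : ℕ) → (Fin r → Mat n) → Poly ℓ
  fTr ℓ A = trace (prodM (λ i → matPolyAt A i))

  -- Layers V₀,…,V_d where layer V_i = Fin (size i).  Layer V_{i} → V_{i+1}
  -- edges (0-indexed i) are labelled by univariate polynomials in the
  -- variable x_{i+1} (Fin index i) of degree < r, given by their r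
  -- coefficients; 'nothing' means there is no edge.

  record ROABP (d w r : ℕ) : Set c where
    field
      size     : ℕ → ℕ                       -- |V_i| (only i ≤ d matters)
      size-≤   : ∀ i → i ≤ d → size i ≤ w
      source   : size 0 ≡ 1
      sink     : size d ≡ 1
      edge     : (i : ℕ) → i < d → Fin (size i) → Fin (size (suc i))
                 → Maybe (Fin r → Carrier)

  module _ {d w r : ℕ} (R : ROABP d w r) where
    open ROABP R

    label : (i : ℕ) → i < d → Fin (size i) → Fin (size (suc i)) → Poly d
    label i p u v with edge i p u v
    ... | just a  = univ (fromℕ< p) a
    ... | nothing = 0P

    -- pathsTo i v = sum over all paths from s ∈ V₀ to v ∈ V_i of the
    -- product of the edge labels along the path
    pathsTo : (i : ℕ) → i ≤ d → Fin (size i) → Poly d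
    pathsTo zero    _ v = 1P
    pathsTo (suc i) p v = sumP (λ u → pathsTo i (<⇒≤ p) u *P label i p u v)

    computes : Poly d
    computes = sumP (λ t → pathsTo d ≤-refl t)

-- Index the 2n² vertices of every interior layer by triples (σ, a, b) with σ ∈ {A, B} and a, b ∈ [n].
-- The source is joined to (σ, a, b) by the entry σ(x₁)[a, b]; between interior layers, (σ, a, b) is joined
-- to (σ, a, b′) by σ(xᵢ)[b, b′]; and (σ, a, b) is joined to the sink by ±σ(x_ℓ)[b, a], with + for A and
-- − for B. By induction the paths reaching (σ, a, b) in layer i sum to the (a, b) entry of σ(x₁)⋯σ(xᵢ), so
-- the source–sink paths sum to tr A(x₁)⋯A(x_ℓ) − tr B(x₁)⋯B(x_ℓ); for ℓ = 1 a single edge labelled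
-- tr A(x₁) − tr B(x₁) suffices. Nothing depends on there being two sequences with weights ±1: any
-- combination Σ_σ α_σ tr M_σ(x₁)⋯M_σ(x_ℓ) of s sequences is computed in width s·n².
module Submission where

open import Defs
open import Level using (Level)
open import Data.Nat using (ℕ; _≤_)
open import Data.Fin using (Fin)
open import Data.Product using (Σ)

open import Algebra.Bundles using (CommutativeSemiring)
open import Data.Empty using (⊥-elim)
open import Data.Fin as Fin using (zero; suc; _↑ˡ_; _↑ʳ_; combine; remQuot)
open import Data.Fin.Properties using (remQuot-combine; suc-injective)
open import Data.List using (List; []; _∷_; _++_; map; concatMap; allFin)
open import Data.List.Properties using (map-tabulate; map-∘)
open import Data.Maybe using (Maybe; just; nothing)
import Data.Nat as ℕ
import Data.Nat.Properties as ℕₚ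
open import Data.Product using (_×_; _,_; proj₁; proj₂; ∃-syntax; map₂)
open import Data.Vec using ([]; _∷_; replicate)
open import Data.Vec.Properties using (≡-dec; ∷-injectiveˡ; ∷-injectiveʳ)
open import Data.Vec.Relation.Binary.Pointwise.Inductive
  using (Pointwise-≡⇒≡; zipWith-comm; zipWith-assoc; zipWith-identityʳ)
open import Function using (_∘_; case_of_)
open import Relation.Binary.Bundles using (Setoid)
open import Relation.Binary.PropositionalEquality as ≡ using (_≡_; _≢_)
open import Relation.Nullary using (Dec; yes; no)

module ListSum {c ℓ} (R : CommutativeSemiring c ℓ) where
  open CommutativeSemiring R hiding (zero)
  open import Algebra.Properties.CommutativeSemigroup +-commutativeSemigroup using (interchange)
  open import Relation.Binary.Reasoning.Setoid setoid

  private variable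
    a b : Level
    X : Set a
    Y : Set b

  sumOver : List X → (X → Carrier) → Carrier
  sumOver xs f = Data.List.foldr (λ x acc → f x + acc) 0# xs

  syntax sumOver xs (λ x → e) = ∑[ x ∈ xs ] e

  sumOver-cong : ∀ (xs : List X) {f g : X → Carrier} → (∀ x → f x ≈ g x) → sumOver xs f ≈ sumOver xs g
  sumOver-cong []       f≈g = refl
  sumOver-cong (x ∷ xs) f≈g = +-cong (f≈g x) (sumOver-cong xs f≈g)

  sumOver-zero : ∀ (xs : List X) {f : X → Carrier} → (∀ x → f x ≈ 0#) → sumOver xs f ≈ 0#
  sumOver-zero []       f≈0 = refl
  sumOver-zero (x ∷ xs) f≈0 = trans (+-cong (f≈0 x) (sumOver-zero xs f≈0)) (+-identityˡ 0#)

  sumOver-++ : ∀ (xs ys : List X) f → sumOver (xs ++ ys) f ≈ sumOver xs f + sumOver ys f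
  sumOver-++ []       ys f = sym (+-identityˡ _)
  sumOver-++ (x ∷ xs) ys f = trans (+-congˡ (sumOver-++ xs ys f)) (sym (+-assoc _ _ _))

  sumOver-+ : ∀ (xs : List X) f g → sumOver xs (λ x → f x + g x) ≈ sumOver xs f + sumOver xs g
  sumOver-+ []       f g = sym (+-identityˡ 0#)
  sumOver-+ (x ∷ xs) f g = trans (+-congˡ (sumOver-+ xs f g)) (interchange _ _ _ _)

  *-distribˡ-sumOver : ∀ (xs : List X) k f → k * sumOver xs f ≈ sumOver xs (λ x → k * f x)
  *-distribˡ-sumOver []       k f = zeroʳ k
  *-distribˡ-sumOver (x ∷ xs) k f = trans (distribˡ k _ _) (+-congˡ (*-distribˡ-sumOver xs k f))

  *-distribʳ-sumOver : ∀ (xs : List X) k f → sumOver xs f * k ≈ sumOver xs (λ x → f x * k)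
  *-distribʳ-sumOver []       k f = zeroˡ k
  *-distribʳ-sumOver (x ∷ xs) k f = trans (distribʳ k _ _) (+-congˡ (*-distribʳ-sumOver xs k f))

  sumOver-map : ∀ (g : X → Y) xs f → sumOver (map g xs) f ≡ sumOver xs (f ∘ g)
  sumOver-map g []       f = ≡.refl
  sumOver-map g (x ∷ xs) f = ≡.cong (f (g x) +_) (sumOver-map g xs f)

  sumOver-concatMap : ∀ (g : X → List Y) xs f →
                      sumOver (concatMap g xs) f ≈ sumOver xs (λ x → sumOver (g x) f)
  sumOver-concatMap g []       f = refl
  sumOver-concatMap g (x ∷ xs) f = trans (sumOver-++ (g x) _ f) (+-congˡ (sumOver-concatMap g xs f))

  sumOver-swap : ∀ (xs : List X) (ys : List Y) (f : X → Y → Carrier) →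
                 sumOver xs (λ x → sumOver ys (f x)) ≈ sumOver ys (λ y → sumOver xs (λ x → f x y))
  sumOver-swap []       ys f = sym (sumOver-zero ys (λ _ → refl))
  sumOver-swap (x ∷ xs) ys f = trans (+-congˡ (sumOver-swap xs ys f)) (sym (sumOver-+ ys (f x) _))

  sumOver-allFin-suc : ∀ m (f : Fin (ℕ.suc m) → Carrier) →
                       sumOver (allFin (ℕ.suc m)) f ≡ f zero + sumOver (allFin m) (f ∘ suc)
  sumOver-allFin-suc m f = ≡.cong (f zero +_)
    (≡.trans (≡.cong (λ xs → sumOver xs f) (≡.sym (map-tabulate Function.id suc))) (sumOver-map suc (allFin m) f))

  sumOver-allFin-+ : ∀ a b (f : Fin (a ℕ.+ b) → Carrier) →
                     sumOver (allFin (a ℕ.+ b)) f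
                       ≈ sumOver (allFin a) (f ∘ (_↑ˡ b)) + sumOver (allFin b) (f ∘ (a ↑ʳ_))
  sumOver-allFin-+ ℕ.zero    b f = sym (+-identityˡ _)
  sumOver-allFin-+ (ℕ.suc a) b f = begin
    sumOver (allFin (ℕ.suc a ℕ.+ b)) f
      ≡⟨ sumOver-allFin-suc (a ℕ.+ b) f ⟩
    f zero + sumOver (allFin (a ℕ.+ b)) (f ∘ suc)
      ≈⟨ +-congˡ (sumOver-allFin-+ a b (f ∘ suc)) ⟩
    f zero + (sumOver (allFin a) (f ∘ suc ∘ (_↑ˡ b)) + right)
      ≈⟨ +-assoc _ _ _ ⟨
    (f zero + sumOver (allFin a) (f ∘ suc ∘ (_↑ˡ b))) + right
      ≡⟨ ≡.cong (_+ right) (sumOver-allFin-suc a (f ∘ (_↑ˡ b))) ⟨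
    sumOver (allFin (ℕ.suc a)) (f ∘ (_↑ˡ b)) + right
      ∎
    where
    right : Carrier
    right = sumOver (allFin b) (f ∘ (ℕ.suc a ↑ʳ_))

  sumOver-allFin-* : ∀ a b (f : Fin (a ℕ.* b) → Carrier) →
                     sumOver (allFin (a ℕ.* b)) f ≈ ∑[ i ∈ allFin a ] sumOver (allFin b) (f ∘ combine i)
  sumOver-allFin-* ℕ.zero    b f = refl
  sumOver-allFin-* (ℕ.suc a) b f = trans (sumOver-allFin-+ b (a ℕ.* b) f)
    (trans (+-congˡ (sumOver-allFin-* a b (f ∘ (b ↑ʳ_)))) (reflexive (≡.sym (sumOver-allFin-suc a _))))

  sumOver-remQuot : ∀ a b (f : Fin a × Fin b → Carrier) →
                    sumOver (allFin (a ℕ.* b)) (f ∘ remQuot b) ≈ ∑[ i ∈ allFin a ] ∑[ j ∈ allFin b ] f (i , j)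
  sumOver-remQuot a b f = trans (sumOver-allFin-* a b (f ∘ remQuot b))
    (sumOver-cong (allFin a) λ i → sumOver-cong (allFin b) λ j → reflexive (≡.cong f (remQuot-combine i j)))

  sumOver-allFin-single : ∀ {m} (f : Fin m → Carrier) i → (∀ j → j ≢ i → f j ≈ 0#) → sumOver (allFin m) f ≈ f i
  sumOver-allFin-single {ℕ.suc m} f zero    f≈0 = trans (reflexive (sumOver-allFin-suc m f))
    (trans (+-congˡ (sumOver-zero (allFin m) λ j → f≈0 (suc j) λ ())) (+-identityʳ _))
  sumOver-allFin-single {ℕ.suc m} f (suc i) f≈0 = trans (reflexive (sumOver-allFin-suc m f))
    (trans (+-cong (f≈0 zero λ ()) (sumOver-allFin-single (f ∘ suc) i λ j j≢i → f≈0 (suc j) (j≢i ∘ suc-injective)))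
      (+-identityˡ _))

module Polynomials {c ℓ'} (F : Field c ℓ') where
  open Field F hiding (zero)
  open ListSum commutativeSemiring
  open import Algebra.Properties.Ring ring using (-1*x≈-x)
  open import Algebra.Properties.CommutativeSemigroup *-commutativeSemigroup using (x∙yz≈y∙xz)
  open import Relation.Binary.Reasoning.Setoid setoid

  private variable
    k : ℕ

  infix  4 _≈ₚ_
  infixl 6 _+ₚ_
  infixl 7 _*ₚ_ _·ₚ_

  _≈ₚ_ : Poly F k → Poly F k → Set ℓ'
  _≈ₚ_ = _≈P_ F

  _+ₚ_ : Poly F k → Poly F k → Poly F k
  _+ₚ_ = _+P_ F

  _*ₚ_ : Poly F k → Poly F k → Poly F k
  _*ₚ_ = _*P_ F

  _·ₚ_ : Carrier → Poly F k → Poly F k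
  a ·ₚ p = map (λ (b , e) → (a * b , e)) p

  ≈ₚ-setoid : ℕ → Setoid c ℓ'
  ≈ₚ-setoid k = record
    { Carrier       = Poly F k
    ; _≈_           = _≈ₚ_
    ; isEquivalence = record
      { refl  = λ _ → refl
      ; sym   = λ p≈q m → sym (p≈q m)
      ; trans = λ p≈q q≈r m → trans (p≈q m) (q≈r m)
      }
    }

  ≡⇒≈ₚ : ∀ {p q : Poly F k} → p ≡ q → p ≈ₚ q
  ≡⇒≈ₚ ≡.refl _ = refl

  addExp-comm : ∀ (e e′ : Monomial F k) → addExp F e e′ ≡ addExp F e′ e
  addExp-comm e e′ = Pointwise-≡⇒≡ (zipWith-comm ℕₚ.+-comm e e′)

  addExp-assoc : ∀ (e e′ e″ : Monomial F k) → addExp F (addExp F e e′) e″ ≡ addExp F e (addExp F e′ e″)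
  addExp-assoc e e′ e″ = Pointwise-≡⇒≡ (zipWith-assoc ℕₚ.+-assoc e e′ e″)

  addExp-identityʳ : ∀ (e : Monomial F k) → addExp F e (replicate k 0) ≡ e
  addExp-identityʳ e = Pointwise-≡⇒≡ (zipWith-identityʳ ℕₚ.+-identityʳ e)

  addExp-cancelʳ : ∀ (u u′ e : Monomial F k) → addExp F u e ≡ addExp F u′ e → u ≡ u′
  addExp-cancelʳ []      []        []      _  = ≡.refl
  addExp-cancelʳ (x ∷ u) (x′ ∷ u′) (y ∷ e) eq =
    ≡.cong₂ _∷_ (ℕₚ.+-cancelʳ-≡ y x x′ (∷-injectiveˡ eq)) (addExp-cancelʳ u u′ e (∷-injectiveʳ eq))

  divides? : ∀ (e m : Monomial F k) → Dec (∃[ m′ ] addExp F m′ e ≡ m)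
  divides? []      []      = yes ([] , ≡.refl)
  divides? (y ∷ e) (x ∷ m) with y ℕₚ.≤? x | divides? e m
  ... | yes y≤x | yes (m′ , m′e≡m) = yes (x ℕ.∸ y ∷ m′ , ≡.cong₂ _∷_ (ℕₚ.m∸n+n≡m y≤x) m′e≡m)
  ... | yes _   | no ∤             = no λ { (_ ∷ m′ , eq) → ∤ (m′ , ∷-injectiveʳ eq) }
  ... | no y≰x  | _                =
    no λ { (z ∷ _ , eq) → y≰x (≡.subst (y ℕ.≤_) (∷-injectiveˡ eq) (ℕₚ.m≤n+m y z)) }

  δ : Monomial F k → Monomial F k → Carrier
  δ e m with ≡-dec ℕ._≟_ e m
  ... | yes _ = 1#
  ... | no  _ = 0#

  δ-≡ : ∀ {e m : Monomial F k} → e ≡ m → δ e m ≈ 1#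
  δ-≡ {e = e} {m} e≡m with ≡-dec ℕ._≟_ e m
  ... | yes _   = refl
  ... | no  e≢m = ⊥-elim (e≢m e≡m)

  δ-≢ : ∀ {e m : Monomial F k} → e ≢ m → δ e m ≈ 0#
  δ-≢ {e = e} {m} e≢m with ≡-dec ℕ._≟_ e m
  ... | yes e≡m = ⊥-elim (e≢m e≡m)
  ... | no  _   = refl

  δ-addExp : ∀ {m′ e m : Monomial F k} → addExp F m′ e ≡ m → ∀ u → δ (addExp F u e) m ≈ δ u m′
  δ-addExp {m′ = m′} {e} ≡.refl u = case ≡-dec ℕ._≟_ u m′ of λ where
    (yes u≡m′) → trans (δ-≡ (≡.cong (λ v → addExp F v e) u≡m′)) (sym (δ-≡ u≡m′))
    (no  u≢m′) → trans (δ-≢ (u≢m′ ∘ addExp-cancelʳ u m′ e)) (sym (δ-≢ u≢m′))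

  coeff-∷ : ∀ a e (p : Poly F k) m → coeff F ((a , e) ∷ p) m ≈ a * δ e m + coeff F p m
  coeff-∷ a e p m with ≡-dec ℕ._≟_ e m
  ... | yes _ = +-congʳ (sym (*-identityʳ a))
  ... | no  _ = sym (trans (+-congʳ (zeroʳ a)) (+-identityˡ _))

  coeff≈sumOver : ∀ (p : Poly F k) m → coeff F p m ≈ sumOver p (λ (a , e) → a * δ e m)
  coeff≈sumOver []            m = refl
  coeff≈sumOver ((a , e) ∷ p) m = trans (coeff-∷ a e p m) (+-congˡ (coeff≈sumOver p m))

  coeff-+ₚ : ∀ (p q : Poly F k) m → coeff F (p +ₚ q) m ≈ coeff F p m + coeff F q m
  coeff-+ₚ p q m = trans (coeff≈sumOver (p ++ q) m)
    (trans (sumOver-++ p q _) (+-cong (sym (coeff≈sumOver p m)) (sym (coeff≈sumOver q m))))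

  coeff-scaleTerms : ∀ (g : Carrier → Carrier) a → (∀ b → g b ≈ a * b) → ∀ (p : Poly F k) m →
                     coeff F (map (λ (b , e) → (g b , e)) p) m ≈ a * coeff F p m
  coeff-scaleTerms g a g≈a* p m = begin
    coeff F (map (λ (b , e) → (g b , e)) p) m
      ≈⟨ coeff≈sumOver (map (λ (b , e) → (g b , e)) p) m ⟩
    sumOver (map (λ (b , e) → (g b , e)) p) (λ (b , e) → b * δ e m)
      ≡⟨ sumOver-map (λ (b , e) → (g b , e)) p _ ⟩
    sumOver p (λ (b , e) → g b * δ e m)
      ≈⟨ sumOver-cong p (λ (b , e) → trans (*-congʳ (g≈a* b)) (*-assoc a b _)) ⟩
    sumOver p (λ (b , e) → a * (b * δ e m))
      ≈⟨ *-distribˡ-sumOver p a _ ⟨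
    a * sumOver p (λ (b , e) → b * δ e m)
      ≈⟨ *-congˡ (coeff≈sumOver p m) ⟨
    a * coeff F p m
      ∎

  coeff-·ₚ : ∀ a (p : Poly F k) m → coeff F (a ·ₚ p) m ≈ a * coeff F p m
  coeff-·ₚ a = coeff-scaleTerms (a *_) a (λ _ → refl)

  coeff--ₚ : ∀ (p : Poly F k) m → coeff F (-P_ F p) m ≈ - coeff F p m
  coeff--ₚ p m = trans (coeff-scaleTerms -_ (- 1#) (sym ∘ -1*x≈-x) p m) (-1*x≈-x _)

  ·ₚ-cong : ∀ a {p q : Poly F k} → p ≈ₚ q → a ·ₚ p ≈ₚ a ·ₚ q
  ·ₚ-cong a {p} {q} p≈q m = trans (coeff-·ₚ a p m) (trans (*-congˡ (p≈q m)) (sym (coeff-·ₚ a q m)))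

  coeff-sumP : ∀ {M} (f : Fin M → Poly F k) m → coeff F (sumP F f) m ≈ ∑[ i ∈ allFin M ] coeff F (f i) m
  coeff-sumP {M = M} f m = go (allFin M)
    where
    go : ∀ is → coeff F (Data.List.foldr (λ i acc → f i +ₚ acc) [] is) m ≈ ∑[ i ∈ is ] coeff F (f i) m
    go []       = refl
    go (i ∷ is) = trans (coeff-+ₚ (f i) _ m) (+-congˡ (go is))

  sumP-cong : ∀ {M} {f g : Fin M → Poly F k} → (∀ i → f i ≈ₚ g i) → sumP F f ≈ₚ sumP F g
  sumP-cong {M = M} {f} {g} f≈g m =
    trans (coeff-sumP f m) (trans (sumOver-cong (allFin M) (λ i → f≈g i m)) (sym (coeff-sumP g m)))

  sumP-zero : ∀ {M} (f : Fin M → Poly F k) → (∀ i → f i ≈ₚ 0P F) → sumP F f ≈ₚ 0P F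
  sumP-zero {M = M} f f≈0 m = trans (coeff-sumP f m) (sumOver-zero (allFin M) (λ i → f≈0 i m))

  sumP-Fin1 : ∀ (f : Fin 1 → Poly F k) → sumP F f ≈ₚ f zero
  sumP-Fin1 f m = trans (coeff-+ₚ (f zero) [] m) (+-identityʳ _)

  sumP-single : ∀ {M} (f : Fin M → Poly F k) i → (∀ j → j ≢ i → f j ≈ₚ 0P F) → sumP F f ≈ₚ f i
  sumP-single f i f≈0 m =
    trans (coeff-sumP f m) (sumOver-allFin-single (λ j → coeff F (f j) m) i (λ j j≢i → f≈0 j j≢i m))

  sumP-swap : ∀ {M N} (f : Fin M → Fin N → Poly F k) →
              sumP F (λ i → sumP F (f i)) ≈ₚ sumP F (λ j → sumP F (λ i → f i j))
  sumP-swap {M = M} {N} f m = begin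
    coeff F (sumP F (λ i → sumP F (f i))) m
      ≈⟨ coeff-sumP (λ i → sumP F (f i)) m ⟩
    ∑[ i ∈ allFin M ] coeff F (sumP F (f i)) m
      ≈⟨ sumOver-cong (allFin M) (λ i → coeff-sumP (f i) m) ⟩
    ∑[ i ∈ allFin M ] ∑[ j ∈ allFin N ] coeff F (f i j) m
      ≈⟨ sumOver-swap (allFin M) (allFin N) _ ⟩
    ∑[ j ∈ allFin N ] ∑[ i ∈ allFin M ] coeff F (f i j) m
      ≈⟨ sumOver-cong (allFin N) (λ j → coeff-sumP (λ i → f i j) m) ⟨
    ∑[ j ∈ allFin N ] coeff F (sumP F (λ i → f i j)) m
      ≈⟨ coeff-sumP (λ j → sumP F (λ i → f i j)) m ⟨
    coeff F (sumP F (λ j → sumP F (λ i → f i j))) m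
      ∎

  sumP-remQuot : ∀ {a b} (f : Fin a × Fin b → Poly F k) →
                 sumP F (f ∘ remQuot b) ≈ₚ sumP F (λ i → sumP F (λ j → f (i , j)))
  sumP-remQuot {a = a} {b} f m = begin
    coeff F (sumP F (f ∘ remQuot b)) m
      ≈⟨ coeff-sumP (f ∘ remQuot b) m ⟩
    ∑[ w ∈ allFin (a ℕ.* b) ] coeff F (f (remQuot b w)) m
      ≈⟨ sumOver-remQuot a b (λ ij → coeff F (f ij) m) ⟩
    ∑[ i ∈ allFin a ] ∑[ j ∈ allFin b ] coeff F (f (i , j)) m
      ≈⟨ sumOver-cong (allFin a) (λ i → coeff-sumP (λ j → f (i , j)) m) ⟨
    ∑[ i ∈ allFin a ] coeff F (sumP F (λ j → f (i , j))) m
      ≈⟨ coeff-sumP (λ i → sumP F (λ j → f (i , j))) m ⟨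
    coeff F (sumP F (λ i → sumP F (λ j → f (i , j)))) m
      ∎

  ·ₚ-distrib-sumP : ∀ a {M} (f : Fin M → Poly F k) → a ·ₚ sumP F f ≈ₚ sumP F (λ i → a ·ₚ f i)
  ·ₚ-distrib-sumP a {M} f m = begin
    coeff F (a ·ₚ sumP F f) m                  ≈⟨ coeff-·ₚ a (sumP F f) m ⟩
    a * coeff F (sumP F f) m                   ≈⟨ *-congˡ (coeff-sumP f m) ⟩
    a * ∑[ i ∈ allFin M ] coeff F (f i) m      ≈⟨ *-distribˡ-sumOver (allFin M) a _ ⟩
    ∑[ i ∈ allFin M ] (a * coeff F (f i) m)    ≈⟨ sumOver-cong (allFin M) (λ i → coeff-·ₚ a (f i) m) ⟨
    ∑[ i ∈ allFin M ] coeff F (a ·ₚ f i) m     ≈⟨ coeff-sumP (λ i → a ·ₚ f i) m ⟨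
    coeff F (sumP F (λ i → a ·ₚ f i)) m        ∎

  sign : Fin 2 → Carrier
  sign zero    = 1#
  sign (suc _) = - 1#

  sumP-sign : ∀ (f : Fin 2 → Poly F k) → sumP F (λ i → sign i ·ₚ f i) ≈ₚ _-P_ F (f zero) (f (suc zero))
  sumP-sign f m = begin
    coeff F (sumP F (λ i → sign i ·ₚ f i)) m
      ≈⟨ coeff-sumP (λ i → sign i ·ₚ f i) m ⟩
    coeff F (1# ·ₚ f zero) m + (coeff F (- 1# ·ₚ f (suc zero)) m + 0#)
      ≈⟨ +-cong (coeff-·ₚ 1# (f zero) m) (+-identityʳ _) ⟩
    1# * coeff F (f zero) m + coeff F (- 1# ·ₚ f (suc zero)) m
      ≈⟨ +-cong (*-identityˡ _) (trans (coeff-·ₚ (- 1#) (f (suc zero)) m) (-1*x≈-x _)) ⟩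
    coeff F (f zero) m + - coeff F (f (suc zero)) m
      ≈⟨ +-congˡ (coeff--ₚ (f (suc zero)) m) ⟨
    coeff F (f zero) m + coeff F (-P_ F (f (suc zero))) m
      ≈⟨ coeff-+ₚ (f zero) (-P_ F (f (suc zero))) m ⟨
    coeff F (_-P_ F (f zero) (f (suc zero))) m
      ∎

  sumOver-*ₚ : ∀ (p q : Poly F k) h →
               sumOver (p *ₚ q) h ≈ sumOver p (λ (a , e) → sumOver q (λ (b , e′) → h (a * b , addExp F e e′)))
  sumOver-*ₚ p q h = trans (sumOver-concatMap _ p h) (sumOver-cong p (λ _ → reflexive (sumOver-map _ q h)))

  coeff-*ₚ : ∀ (p q : Poly F k) m →
             coeff F (p *ₚ q) m ≈ sumOver p (λ (a , e) → sumOver q (λ (b , e′) → (a * b) * δ (addExp F e e′) m))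
  coeff-*ₚ p q m = trans (coeff≈sumOver (p *ₚ q) m) (sumOver-*ₚ p q _)

  -- The coefficient of x^m in q · x^e. It depends on q only through its coefficients, which is what makes
  -- products respect ≈ₚ even though they are computed on term lists.
  shiftedCoeff : Poly F k → Monomial F k → Monomial F k → Carrier
  shiftedCoeff q e m with divides? e m
  ... | yes (m′ , _) = coeff F q m′
  ... | no  _        = 0#

  sumOver-δ-addExp : ∀ (q : Poly F k) e m → sumOver q (λ (b , u) → b * δ (addExp F u e) m) ≈ shiftedCoeff q e m
  sumOver-δ-addExp q e m with divides? e m
  ... | yes (m′ , m′e≡m) =
    trans (sumOver-cong q (λ (b , u) → *-congˡ (δ-addExp m′e≡m u))) (sym (coeff≈sumOver q m′))
  ... | no  ∤ = sumOver-zero q (λ (b , u) → trans (*-congˡ (δ-≢ (λ eq → ∤ (u , eq)))) (zeroʳ b))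

  coeff-*ₚ-shifted : ∀ (p q : Poly F k) m → coeff F (p *ₚ q) m ≈ sumOver p (λ (a , e) → a * shiftedCoeff q e m)
  coeff-*ₚ-shifted p q m = trans (coeff-*ₚ p q m) (sumOver-cong p λ (a , e) → begin
    sumOver q (λ (b , u) → (a * b) * δ (addExp F e u) m)
      ≈⟨ sumOver-cong q (λ (b , u) → trans (*-assoc a b _) (*-congˡ (*-congˡ (δ-cong (addExp-comm e u))))) ⟩
    sumOver q (λ (b , u) → a * (b * δ (addExp F u e) m))
      ≈⟨ *-distribˡ-sumOver q a _ ⟨
    a * sumOver q (λ (b , u) → b * δ (addExp F u e) m)
      ≈⟨ *-congˡ (sumOver-δ-addExp q e m) ⟩
    a * shiftedCoeff q e m
      ∎)
    where
    δ-cong : ∀ {e e′} → e ≡ e′ → δ e m ≈ δ e′ m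
    δ-cong eq = reflexive (≡.cong (λ v → δ v m) eq)

  shiftedCoeff-cong : ∀ {q q′ : Poly F k} → q ≈ₚ q′ → ∀ e m → shiftedCoeff q e m ≈ shiftedCoeff q′ e m
  shiftedCoeff-cong q≈q′ e m with divides? e m
  ... | yes (m′ , _) = q≈q′ m′
  ... | no  _        = refl

  shiftedCoeff-sumP : ∀ {M} (f : Fin M → Poly F k) e m →
                      shiftedCoeff (sumP F f) e m ≈ ∑[ i ∈ allFin M ] shiftedCoeff (f i) e m
  shiftedCoeff-sumP {M = M} f e m with divides? e m
  ... | yes (m′ , _) = coeff-sumP f m′
  ... | no  _        = sym (sumOver-zero (allFin M) (λ _ → refl))

  shiftedCoeff-·ₚ : ∀ a (q : Poly F k) e m → shiftedCoeff (a ·ₚ q) e m ≈ a * shiftedCoeff q e m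
  shiftedCoeff-·ₚ a q e m with divides? e m
  ... | yes (m′ , _) = coeff-·ₚ a q m′
  ... | no  _        = sym (zeroʳ a)

  *ₚ-comm : ∀ (p q : Poly F k) → p *ₚ q ≈ₚ q *ₚ p
  *ₚ-comm p q m = begin
    coeff F (p *ₚ q) m
      ≈⟨ coeff-*ₚ p q m ⟩
    sumOver p (λ (a , e) → sumOver q (λ (b , u) → (a * b) * δ (addExp F e u) m))
      ≈⟨ sumOver-swap p q _ ⟩
    sumOver q (λ (b , u) → sumOver p (λ (a , e) → (a * b) * δ (addExp F e u) m))
      ≈⟨ sumOver-cong q (λ (b , u) → sumOver-cong p (λ (a , e) →
           *-cong (*-comm a b) (reflexive (≡.cong (λ v → δ v m) (addExp-comm e u))))) ⟩
    sumOver q (λ (b , u) → sumOver p (λ (a , e) → (b * a) * δ (addExp F u e) m))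
      ≈⟨ coeff-*ₚ q p m ⟨
    coeff F (q *ₚ p) m
      ∎

  *ₚ-congʳ : ∀ (p : Poly F k) {q q′} → q ≈ₚ q′ → p *ₚ q ≈ₚ p *ₚ q′
  *ₚ-congʳ p q≈q′ m = trans (coeff-*ₚ-shifted p _ m)
    (trans (sumOver-cong p (λ (a , e) → *-congˡ (shiftedCoeff-cong q≈q′ e m))) (sym (coeff-*ₚ-shifted p _ m)))

  *ₚ-congˡ : ∀ {p p′ : Poly F k} q → p ≈ₚ p′ → p *ₚ q ≈ₚ p′ *ₚ q
  *ₚ-congˡ {p = p} {p′} q p≈p′ m = trans (*ₚ-comm p q m) (trans (*ₚ-congʳ q p≈p′ m) (*ₚ-comm q p′ m))

  *ₚ-cong : ∀ {p p′ q q′ : Poly F k} → p ≈ₚ p′ → q ≈ₚ q′ → p *ₚ q ≈ₚ p′ *ₚ q′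
  *ₚ-cong {p = p} {p′} {q} p≈p′ q≈q′ m = trans (*ₚ-congˡ {p = p} {p′} q p≈p′ m) (*ₚ-congʳ p′ q≈q′ m)

  *ₚ-assoc : ∀ (p q r : Poly F k) → (p *ₚ q) *ₚ r ≈ₚ p *ₚ (q *ₚ r)
  *ₚ-assoc p q r m = begin
    coeff F ((p *ₚ q) *ₚ r) m
      ≈⟨ coeff-*ₚ (p *ₚ q) r m ⟩
    sumOver (p *ₚ q) (λ (ab , e) → sumOver r (λ (c , e″) → (ab * c) * δ (addExp F e e″) m))
      ≈⟨ sumOver-*ₚ p q _ ⟩
    sumOver p (λ (a , e) → sumOver q (λ (b , e′) → sumOver r (λ (c , e″) →
      ((a * b) * c) * δ (addExp F (addExp F e e′) e″) m)))
      ≈⟨ sumOver-cong p (λ (a , e) → sumOver-cong q (λ (b , e′) → sumOver-cong r (λ (c , e″) →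
           *-cong (*-assoc a b c) (reflexive (≡.cong (λ v → δ v m) (addExp-assoc e e′ e″)))))) ⟩
    sumOver p (λ (a , e) → sumOver q (λ (b , e′) → sumOver r (λ (c , e″) →
      (a * (b * c)) * δ (addExp F e (addExp F e′ e″)) m)))
      ≈⟨ sumOver-cong p (λ (a , e) → sumOver-*ₚ q r _) ⟨
    sumOver p (λ (a , e) → sumOver (q *ₚ r) (λ (bc , e′) → (a * bc) * δ (addExp F e e′) m))
      ≈⟨ coeff-*ₚ p (q *ₚ r) m ⟨
    coeff F (p *ₚ (q *ₚ r)) m
      ∎

  *ₚ-distribˡ-sumP : ∀ (p : Poly F k) {M} (f : Fin M → Poly F k) → p *ₚ sumP F f ≈ₚ sumP F (λ i → p *ₚ f i)
  *ₚ-distribˡ-sumP p {M} f m = begin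
    coeff F (p *ₚ sumP F f) m
      ≈⟨ coeff-*ₚ-shifted p (sumP F f) m ⟩
    sumOver p (λ (a , e) → a * shiftedCoeff (sumP F f) e m)
      ≈⟨ sumOver-cong p (λ (a , e) →
           trans (*-congˡ (shiftedCoeff-sumP f e m)) (*-distribˡ-sumOver (allFin M) a _)) ⟩
    sumOver p (λ (a , e) → ∑[ i ∈ allFin M ] (a * shiftedCoeff (f i) e m))
      ≈⟨ sumOver-swap p (allFin M) _ ⟩
    ∑[ i ∈ allFin M ] sumOver p (λ (a , e) → a * shiftedCoeff (f i) e m)
      ≈⟨ sumOver-cong (allFin M) (λ i → coeff-*ₚ-shifted p (f i) m) ⟨
    ∑[ i ∈ allFin M ] coeff F (p *ₚ f i) m
      ≈⟨ coeff-sumP (λ i → p *ₚ f i) m ⟨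
    coeff F (sumP F (λ i → p *ₚ f i)) m
      ∎

  *ₚ-distribʳ-sumP : ∀ {M} (f : Fin M → Poly F k) q → sumP F f *ₚ q ≈ₚ sumP F (λ i → f i *ₚ q)
  *ₚ-distribʳ-sumP f q m = trans (*ₚ-comm (sumP F f) q m)
    (trans (*ₚ-distribˡ-sumP q f m) (sumP-cong (λ i → *ₚ-comm q (f i)) m))

  *ₚ-·ₚʳ : ∀ (p : Poly F k) a q → p *ₚ (a ·ₚ q) ≈ₚ a ·ₚ (p *ₚ q)
  *ₚ-·ₚʳ p a q m = begin
    coeff F (p *ₚ (a ·ₚ q)) m
      ≈⟨ coeff-*ₚ-shifted p (a ·ₚ q) m ⟩
    sumOver p (λ (b , e) → b * shiftedCoeff (a ·ₚ q) e m)
      ≈⟨ sumOver-cong p (λ (b , e) → trans (*-congˡ (shiftedCoeff-·ₚ a q e m)) (x∙yz≈y∙xz b a _)) ⟩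
    sumOver p (λ (b , e) → a * (b * shiftedCoeff q e m))
      ≈⟨ *-distribˡ-sumOver p a _ ⟨
    a * sumOver p (λ (b , e) → b * shiftedCoeff q e m)
      ≈⟨ *-congˡ (coeff-*ₚ-shifted p q m) ⟨
    a * coeff F (p *ₚ q) m
      ≈⟨ coeff-·ₚ a (p *ₚ q) m ⟨
    coeff F (a ·ₚ (p *ₚ q)) m
      ∎

  *ₚ-identityʳ : ∀ (p : Poly F k) → p *ₚ 1P F ≈ₚ p
  *ₚ-identityʳ p m = trans (coeff-*ₚ p (1P F) m) (trans (sumOver-cong p (λ (a , e) →
      trans (+-identityʳ _) (*-cong (*-identityʳ a) (reflexive (≡.cong (λ v → δ v m) (addExp-identityʳ e))))))
    (sym (coeff≈sumOver p m)))

  *ₚ-identityˡ : ∀ (p : Poly F k) → 1P F *ₚ p ≈ₚ p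
  *ₚ-identityˡ p m = trans (*ₚ-comm (1P F) p m) (*ₚ-identityʳ p m)

  *ₚ-zeroʳ : ∀ (p : Poly F k) → p *ₚ 0P F ≈ₚ 0P F
  *ₚ-zeroʳ p m = trans (coeff-*ₚ p [] m) (sumOver-zero p (λ _ → refl))

  coeff-univ : ∀ {r} (x : Fin k) (a : Fin r → Carrier) m →
               coeff F (univ F x a) m ≈ ∑[ j ∈ allFin r ] (a j * δ (varPow F x (Fin.toℕ j)) m)
  coeff-univ {r = r} x a m = trans (coeff≈sumOver (univ F x a) m) (reflexive (sumOver-map _ (allFin r) _))

  univ-·ₚ : ∀ {r} (x : Fin k) a (b : Fin r → Carrier) → univ F x (λ j → a * b j) ≡ a ·ₚ univ F x b
  univ-·ₚ {r = r} x a b = map-∘ (allFin r)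

  univ-sumOver : ∀ {r M} (x : Fin k) (g : Fin M → Fin r → Carrier) →
                 univ F x (λ j → ∑[ i ∈ allFin M ] g i j) ≈ₚ sumP F (λ i → univ F x (g i))
  univ-sumOver {r = r} {M} x g m = begin
    coeff F (univ F x (λ j → ∑[ i ∈ allFin M ] g i j)) m
      ≈⟨ coeff-univ x (λ j → ∑[ i ∈ allFin M ] g i j) m ⟩
    ∑[ j ∈ allFin r ] ((∑[ i ∈ allFin M ] g i j) * δ (varPow F x (Fin.toℕ j)) m)
      ≈⟨ sumOver-cong (allFin r) (λ j → *-distribʳ-sumOver (allFin M) _ _) ⟩
    ∑[ j ∈ allFin r ] ∑[ i ∈ allFin M ] (g i j * δ (varPow F x (Fin.toℕ j)) m)
      ≈⟨ sumOver-swap (allFin r) (allFin M) _ ⟩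
    ∑[ i ∈ allFin M ] ∑[ j ∈ allFin r ] (g i j * δ (varPow F x (Fin.toℕ j)) m)
      ≈⟨ sumOver-cong (allFin M) (λ i → coeff-univ x (g i) m) ⟨
    ∑[ i ∈ allFin M ] coeff F (univ F x (g i)) m
      ≈⟨ coeff-sumP (λ i → univ F x (g i)) m ⟨
    coeff F (sumP F (λ i → univ F x (g i))) m
      ∎

module PolynomialMatrices {c ℓ'} (F : Field c ℓ') where
  open Field F hiding (zero)
  open Polynomials F

  private variable
    k n : ℕ

  infix  4 _≈ₘ_
  infixl 7 _*ₘ_

  _≈ₘ_ : PMat F k n → PMat F k n → Set ℓ'
  P ≈ₘ Q = ∀ a b → P a b ≈ₚ Q a b

  _*ₘ_ : PMat F k n → PMat F k n → PMat F k n
  _*ₘ_ = _*M_ F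

  ≈ₘ-setoid : ℕ → ℕ → Setoid c ℓ'
  ≈ₘ-setoid k n = record
    { Carrier       = PMat F k n
    ; _≈_           = _≈ₘ_
    ; isEquivalence = record
      { refl  = λ _ _ _ → refl
      ; sym   = λ P≈Q a b m → sym (P≈Q a b m)
      ; trans = λ P≈Q Q≈R a b m → trans (P≈Q a b m) (Q≈R a b m)
      }
    }

  *ₘ-cong : ∀ {P P′ Q Q′ : PMat F k n} → P ≈ₘ P′ → Q ≈ₘ Q′ → P *ₘ Q ≈ₘ P′ *ₘ Q′
  *ₘ-cong {P = P} {P′} {Q} {Q′} P≈P′ Q≈Q′ a b =
    sumP-cong (λ t → *ₚ-cong {p = P a t} {P′ a t} {Q t b} {Q′ t b} (P≈P′ a t) (Q≈Q′ t b))

  *ₘ-assoc : ∀ (P Q R : PMat F k n) → (P *ₘ Q) *ₘ R ≈ₘ P *ₘ (Q *ₘ R)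
  *ₘ-assoc {k = k} P Q R a b = begin
    sumP F (λ t → sumP F (λ u → P a u *ₚ Q u t) *ₚ R t b)
      ≈⟨ sumP-cong (λ t → *ₚ-distribʳ-sumP (λ u → P a u *ₚ Q u t) (R t b)) ⟩
    sumP F (λ t → sumP F (λ u → (P a u *ₚ Q u t) *ₚ R t b))
      ≈⟨ sumP-cong (λ t → sumP-cong (λ u → *ₚ-assoc (P a u) (Q u t) (R t b))) ⟩
    sumP F (λ t → sumP F (λ u → P a u *ₚ (Q u t *ₚ R t b)))
      ≈⟨ sumP-swap (λ t u → P a u *ₚ (Q u t *ₚ R t b)) ⟩
    sumP F (λ u → sumP F (λ t → P a u *ₚ (Q u t *ₚ R t b)))
      ≈⟨ sumP-cong (λ u → *ₚ-distribˡ-sumP (P a u) (λ t → Q u t *ₚ R t b)) ⟨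
    sumP F (λ u → P a u *ₚ sumP F (λ t → Q u t *ₚ R t b))
      ∎
    where open import Relation.Binary.Reasoning.Setoid (≈ₚ-setoid k)

  *ₘ-identityʳ : ∀ (P : PMat F k n) → P *ₘ idM F ≈ₘ P
  *ₘ-identityʳ {k = k} P a b = begin
    sumP F (λ t → P a t *ₚ idM F t b)   ≈⟨ sumP-single (λ t → P a t *ₚ idM F t b) b offDiagonal ⟩
    P a b *ₚ idM F b b                  ≈⟨ diagonal ⟩
    P a b                               ∎
    where
    open import Relation.Binary.Reasoning.Setoid (≈ₚ-setoid k)
    offDiagonal : ∀ t → t ≢ b → P a t *ₚ idM F t b ≈ₚ 0P F
    offDiagonal t t≢b with t Fin.≟ b
    ... | yes t≡b = ⊥-elim (t≢b t≡b)
    ... | no  _   = *ₚ-zeroʳ (P a t)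
    diagonal : P a b *ₚ idM F b b ≈ₚ P a b
    diagonal with b Fin.≟ b
    ... | yes _   = *ₚ-identityʳ (P a b)
    ... | no  b≢b = ⊥-elim (b≢b ≡.refl)

  -- X₀ ⋯ X_j nested to the left, as in the recursion of pathsTo (prodM nests to the right). The bound is
  -- irrelevant, so every proof of j < ℓ, in particular those carried by pathsTo, gives the same matrix.
  prefixProd : ∀ {ℓ} → (Fin ℓ → PMat F k n) → (j : ℕ) → .(j ℕ.< ℓ) → PMat F k n
  prefixProd X ℕ.zero    j<ℓ = X (Fin.fromℕ< j<ℓ)
  prefixProd X (ℕ.suc j) j<ℓ = prefixProd X j (ℕₚ.<⇒≤ j<ℓ) *ₘ X (Fin.fromℕ< j<ℓ)

  prefixProd-unfoldˡ : ∀ {m} (X : Fin (ℕ.suc m) → PMat F k n) j (1+j<1+m : ℕ.suc j ℕ.< ℕ.suc m) →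
                       prefixProd X (ℕ.suc j) 1+j<1+m ≈ₘ X zero *ₘ prefixProd (X ∘ suc) j (ℕ.s<s⁻¹ 1+j<1+m)
  prefixProd-unfoldˡ X ℕ.zero    (ℕ.s≤s (ℕ.s≤s _)) a b m = refl
  prefixProd-unfoldˡ {k = k} {n} X (ℕ.suc j) 1+j<1+m = begin
    prefixProd X (ℕ.suc j) (ℕₚ.<⇒≤ 1+j<1+m) *ₘ Xj
      ≈⟨ *ₘ-cong {P = prefixProd X (ℕ.suc j) (ℕₚ.<⇒≤ 1+j<1+m)} {X zero *ₘ X′} {Xj} {Xj}
                 (prefixProd-unfoldˡ X j (ℕₚ.<⇒≤ 1+j<1+m)) (λ _ _ _ → refl) ⟩
    (X zero *ₘ X′) *ₘ Xj
      ≈⟨ *ₘ-assoc (X zero) X′ Xj ⟩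
    X zero *ₘ (X′ *ₘ Xj)
      ∎
    where
    open import Relation.Binary.Reasoning.Setoid (≈ₘ-setoid k n)
    X′ Xj : PMat F k n
    X′ = prefixProd (X ∘ suc) j (ℕ.s<s⁻¹ (ℕₚ.<⇒≤ 1+j<1+m))
    Xj = X (Fin.fromℕ< 1+j<1+m)

  prodM≈prefixProd : ∀ {m} (X : Fin (ℕ.suc m) → PMat F k n) → prodM F X ≈ₘ prefixProd X m (ℕₚ.n<1+n m)
  prodM≈prefixProd {m = ℕ.zero}  X = *ₘ-identityʳ (X zero)
  prodM≈prefixProd {k = k} {n} {m = ℕ.suc m} X = begin
    X zero *ₘ prodM F (X ∘ suc)
      ≈⟨ *ₘ-cong {P = X zero} {X zero} {prodM F (X ∘ suc)} {X′}
                 (λ _ _ _ → refl) (prodM≈prefixProd (X ∘ suc)) ⟩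
    X zero *ₘ X′
      ≈⟨ prefixProd-unfoldˡ X m (ℕₚ.n<1+n (ℕ.suc m)) ⟨
    prefixProd X (ℕ.suc m) (ℕₚ.n<1+n (ℕ.suc m))
      ∎
    where
    open import Relation.Binary.Reasoning.Setoid (≈ₘ-setoid k n)
    X′ : PMat F k n
    X′ = prefixProd (X ∘ suc) m (ℕₚ.n<1+n m)

  trace-prodM : ∀ {m} (X : Fin (ℕ.suc m) → PMat F k n) →
                trace F (prodM F X) ≈ₚ trace F (prefixProd X m (ℕₚ.n<1+n m))
  trace-prodM X = sumP-cong (λ a → prodM≈prefixProd X a a)

module ROABPLabels {c ℓ'} (F : Field c ℓ') where
  open Field F using (Carrier)

  edgeLabel : ∀ {d r} → Fin d → Maybe (Fin r → Carrier) → Poly F d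
  edgeLabel x (just a) = univ F x a
  edgeLabel x nothing  = 0P F

  label≡edgeLabel : ∀ {d w r} (R : ROABP F d w r) i (i<d : i ℕ.< d) u v →
                    label F R i i<d u v ≡ edgeLabel (Fin.fromℕ< i<d) (ROABP.edge R i i<d u v)
  label≡edgeLabel R i i<d u v with ROABP.edge R i i<d u v
  ... | just _  = ≡.refl
  ... | nothing = ≡.refl

module TraceCombination {c ℓ'} (F : Field c ℓ') {n r s : ℕ}
                        (M : Fin s → Fin r → Mat F n) (α : Fin s → Field.Carrier F) where
  open Field F hiding (zero)
  open ListSum commutativeSemiring
  open Polynomials F
  open PolynomialMatrices F
  open ROABPLabels F

  width : ℕ
  width = s ℕ.* (n ℕ.* n)

  Vertex : Set
  Vertex = Fin s × Fin n × Fin n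

  Coeffs : Set c
  Coeffs = Fin r → Carrier

  decode : Fin width → Vertex
  decode = map₂ (remQuot n) ∘ remQuot (n ℕ.* n)

  sumP-decode : ∀ {k} (f : Vertex → Poly F k) →
                sumP F (f ∘ decode) ≈ₚ sumP F (λ σ → sumP F (λ a → sumP F (λ b → f (σ , a , b))))
  sumP-decode {k} f = begin
    sumP F (f ∘ decode)
      ≈⟨ sumP-remQuot (f ∘ map₂ (remQuot n)) ⟩
    sumP F (λ σ → sumP F (λ ab → f (σ , remQuot n ab)))
      ≈⟨ sumP-cong (λ σ → sumP-remQuot (λ ab → f (σ , ab))) ⟩
    sumP F (λ σ → sumP F (λ a → sumP F (λ b → f (σ , a , b))))
      ∎
    where open import Relation.Binary.Reasoning.Setoid (≈ₚ-setoid k)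

  continueEdge : Vertex → Vertex → Maybe Coeffs
  continueEdge (σ , a , b) (σ′ , a′ , b′) with σ Fin.≟ σ′ | a Fin.≟ a′
  ... | yes ≡.refl | yes ≡.refl = just (λ j → M σ j b b′)
  ... | _          | _          = nothing

  closeEdge : Vertex → Maybe Coeffs
  closeEdge (σ , a , b) = just (λ j → α σ * M σ j b a)

  continueEdge-diag : ∀ σ a b b′ → continueEdge (σ , a , b) (σ , a , b′) ≡ just (λ j → M σ j b b′)
  continueEdge-diag σ a b b′ with σ Fin.≟ σ | a Fin.≟ a
  ... | yes ≡.refl | yes ≡.refl = ≡.refl
  ... | no σ≢σ     | _          = ⊥-elim (σ≢σ ≡.refl)
  ... | yes ≡.refl | no a≢a     = ⊥-elim (a≢a ≡.refl)

  continueEdge-≢ˡ : ∀ {σ σ′} a b a′ b′ → σ ≢ σ′ → continueEdge (σ , a , b) (σ′ , a′ , b′) ≡ nothing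
  continueEdge-≢ˡ {σ} {σ′} a b a′ b′ σ≢σ′ with σ Fin.≟ σ′ | a Fin.≟ a′
  ... | yes σ≡σ′ | _ = ⊥-elim (σ≢σ′ σ≡σ′)
  ... | no _     | _ = ≡.refl

  continueEdge-≢ʳ : ∀ σ {a a′} b b′ → a ≢ a′ → continueEdge (σ , a , b) (σ , a′ , b′) ≡ nothing
  continueEdge-≢ʳ σ {a} {a′} b b′ a≢a′ with σ Fin.≟ σ | a Fin.≟ a′
  ... | _          | yes a≡a′ = ⊥-elim (a≢a′ a≡a′)
  ... | yes ≡.refl | no _     = ≡.refl
  ... | no _       | no _     = ≡.refl

  sumP-continueEdge : ∀ {k} (x : Fin k) (E : Vertex → Poly F k) σ′ a′ b′ →
    sumP F (λ w → E (decode w) *ₚ edgeLabel x (continueEdge (decode w) (σ′ , a′ , b′)))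
      ≈ₚ sumP F (λ b → E (σ′ , a′ , b) *ₚ matPolyAt F (M σ′) x b b′)
  sumP-continueEdge {k} x E σ′ a′ b′ = begin
    sumP F (term ∘ decode)                                         ≈⟨ sumP-decode term ⟩
    sumP F (λ σ → sumP F (λ a → sumP F (λ b → term (σ , a , b))))  ≈⟨ sumP-single _ σ′ otherσ ⟩
    sumP F (λ a → sumP F (λ b → term (σ′ , a , b)))                ≈⟨ sumP-single _ a′ otherA ⟩
    sumP F (λ b → term (σ′ , a′ , b))                              ≈⟨ sumP-cong diagonal ⟩
    sumP F (λ b → E (σ′ , a′ , b) *ₚ matPolyAt F (M σ′) x b b′)    ∎
    where
    open import Relation.Binary.Reasoning.Setoid (≈ₚ-setoid k)
    term : Vertex → Poly F k
    term v = E v *ₚ edgeLabel x (continueEdge v (σ′ , a′ , b′))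
    noEdge : ∀ {v} → continueEdge v (σ′ , a′ , b′) ≡ nothing → term v ≈ₚ 0P F
    noEdge {v} eq rewrite eq = *ₚ-zeroʳ (E v)
    otherσ : ∀ σ → σ ≢ σ′ → sumP F (λ a → sumP F (λ b → term (σ , a , b))) ≈ₚ 0P F
    otherσ σ σ≢σ′ = sumP-zero _ λ a → sumP-zero _ λ b → noEdge (continueEdge-≢ˡ a b a′ b′ σ≢σ′)
    otherA : ∀ a → a ≢ a′ → sumP F (λ b → term (σ′ , a , b)) ≈ₚ 0P F
    otherA a a≢a′ = sumP-zero _ λ b → noEdge (continueEdge-≢ʳ σ′ b b′ a≢a′)
    diagonal : ∀ b → term (σ′ , a′ , b) ≈ₚ E (σ′ , a′ , b) *ₚ matPolyAt F (M σ′) x b b′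
    diagonal b rewrite continueEdge-diag σ′ a′ b b′ = λ _ → refl

  sumP-closeEdge : ∀ {k} (x : Fin k) (E : Vertex → Poly F k) →
    sumP F (λ w → E (decode w) *ₚ edgeLabel x (closeEdge (decode w)))
      ≈ₚ sumP F (λ σ → α σ ·ₚ sumP F (λ a → sumP F (λ b → E (σ , a , b) *ₚ matPolyAt F (M σ) x b a)))
  sumP-closeEdge {k} x E = begin
    sumP F (term ∘ decode)
      ≈⟨ sumP-decode term ⟩
    sumP F (λ σ → sumP F (λ a → sumP F (λ b → term (σ , a , b))))
      ≈⟨ sumP-cong (λ σ → sumP-cong (λ a → sumP-cong (λ b → scaled σ a b))) ⟩
    sumP F (λ σ → sumP F (λ a → sumP F (λ b → α σ ·ₚ entry σ a b)))
      ≈⟨ sumP-cong (λ σ → sumP-cong (λ a → ·ₚ-distrib-sumP (α σ) (entry σ a))) ⟨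
    sumP F (λ σ → sumP F (λ a → α σ ·ₚ sumP F (entry σ a)))
      ≈⟨ sumP-cong (λ σ → ·ₚ-distrib-sumP (α σ) (λ a → sumP F (entry σ a))) ⟨
    sumP F (λ σ → α σ ·ₚ sumP F (λ a → sumP F (entry σ a)))
      ∎
    where
    open import Relation.Binary.Reasoning.Setoid (≈ₚ-setoid k)
    term : Vertex → Poly F k
    term v = E v *ₚ edgeLabel x (closeEdge v)
    entry : Fin s → Fin n → Fin n → Poly F k
    entry σ a b = E (σ , a , b) *ₚ matPolyAt F (M σ) x b a
    scaled : ∀ σ a b → term (σ , a , b) ≈ₚ α σ ·ₚ entry σ a b
    scaled σ a b rewrite univ-·ₚ x (α σ) (λ j → M σ j b a) = *ₚ-·ₚʳ (E (σ , a , b)) (α σ) _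

  sumP-fTr≈trace-prefixProd : ∀ k → sumP F (λ σ → α σ ·ₚ fTr F (ℕ.suc k) (M σ))
    ≈ₚ sumP F (λ σ → α σ ·ₚ trace F (prefixProd (matPolyAt F (M σ)) k (ℕₚ.n<1+n k)))
  sumP-fTr≈trace-prefixProd k = sumP-cong λ σ →
    ·ₚ-cong (α σ) {fTr F (ℕ.suc k) (M σ)} {trace F (prefixProd (matPolyAt F (M σ)) k (ℕₚ.n<1+n k))}
            (trace-prodM (matPolyAt F (M σ)))

  -- innerWidth k i is the number of vertices in layer i + 1 of the depth k + 1 program:
  -- layers 1, …, k are interior, layer k + 1 is the sink.
  innerWidth : ℕ → ℕ → ℕ
  innerWidth ℕ.zero    _         = 1
  innerWidth (ℕ.suc k) ℕ.zero    = width
  innerWidth (ℕ.suc k) (ℕ.suc i) = innerWidth k i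

  innerWidth-≤ : 1 ≤ width → ∀ k i → innerWidth k i ≤ width
  innerWidth-≤ 1≤width ℕ.zero    _         = 1≤width
  innerWidth-≤ 1≤width (ℕ.suc k) ℕ.zero    = ℕₚ.≤-refl
  innerWidth-≤ 1≤width (ℕ.suc k) (ℕ.suc i) = innerWidth-≤ 1≤width k i

  innerWidth-diag : ∀ k → innerWidth k k ≡ 1
  innerWidth-diag ℕ.zero    = ≡.refl
  innerWidth-diag (ℕ.suc k) = innerWidth-diag k

  asInner : ∀ k i → i ℕ.< k → Fin (innerWidth k i) → Fin width
  asInner (ℕ.suc k) ℕ.zero    _           v = v
  asInner (ℕ.suc k) (ℕ.suc i) (ℕ.s≤s i<k) v = asInner k i i<k v

  sumP-asInner : ∀ {d} k i (i<k : i ℕ.< k) (f : Fin width → Poly F d) → sumP F (f ∘ asInner k i i<k) ≡ sumP F f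
  sumP-asInner (ℕ.suc k) ℕ.zero    _           f = ≡.refl
  sumP-asInner (ℕ.suc k) (ℕ.suc i) (ℕ.s≤s i<k) f = sumP-asInner k i i<k f

  sumP-sink : ∀ {d} k (f : Fin (innerWidth k k) → Poly F d) {p} → (∀ t → f t ≈ₚ p) → sumP F f ≈ₚ p
  sumP-sink ℕ.zero    f     f≈p m = trans (sumP-Fin1 f m) (f≈p zero m)
  sumP-sink (ℕ.suc k) f {p} f≈p   = sumP-sink k f {p} f≈p

  firstEdge : ∀ k → Fin (innerWidth k 0) → Maybe Coeffs
  firstEdge ℕ.zero    _ = just (λ j → ∑[ σ ∈ allFin s ] (α σ * ∑[ a ∈ allFin n ] M σ j a a))
  firstEdge (ℕ.suc k) v = just (λ j → let (σ , a , b) = decode v in M σ j a b)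

  laterEdge : ∀ k i → Fin (innerWidth k i) → Fin (innerWidth k (ℕ.suc i)) → Maybe Coeffs
  laterEdge ℕ.zero            _         _ _ = nothing
  laterEdge (ℕ.suc k)         (ℕ.suc i) u v = laterEdge k i u v
  laterEdge (ℕ.suc ℕ.zero)    ℕ.zero    u _ = closeEdge (decode u)
  laterEdge (ℕ.suc (ℕ.suc k)) ℕ.zero    u v = continueEdge (decode u) (decode v)

  laterEdge-continue : ∀ k j (j<k : j ℕ.< k) (1+j<k : ℕ.suc j ℕ.< k) u v →
    laterEdge k j u v ≡ continueEdge (decode (asInner k j j<k u)) (decode (asInner k (ℕ.suc j) 1+j<k v))
  laterEdge-continue (ℕ.suc ℕ.zero)    ℕ.zero    _           (ℕ.s≤s ())    u v
  laterEdge-continue (ℕ.suc (ℕ.suc k)) ℕ.zero    _           (ℕ.s≤s _)     u v = ≡.refl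
  laterEdge-continue (ℕ.suc k)         (ℕ.suc j) (ℕ.s≤s j<k) (ℕ.s≤s 1+j<k) u v =
    laterEdge-continue k j j<k 1+j<k u v

  laterEdge-close : ∀ k (k<1+k : k ℕ.< ℕ.suc k) u v →
                    laterEdge (ℕ.suc k) k u v ≡ closeEdge (decode (asInner (ℕ.suc k) k k<1+k u))
  laterEdge-close ℕ.zero    _             u v = ≡.refl
  laterEdge-close (ℕ.suc k) (ℕ.s≤s k<1+k) u v = laterEdge-close k k<1+k u v

  layerSize : ℕ → ℕ → ℕ
  layerSize k ℕ.zero    = 1
  layerSize k (ℕ.suc i) = innerWidth k i

  roabp : ∀ k → 1 ≤ width → ROABP F (ℕ.suc k) width r
  roabp k 1≤width = record
    { size   = layerSize k
    ; size-≤ = λ where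
        ℕ.zero    _ → 1≤width
        (ℕ.suc i) _ → innerWidth-≤ 1≤width k i
    ; source = ≡.refl
    ; sink   = innerWidth-diag k
    ; edge   = λ where
        ℕ.zero    _ _ v → firstEdge k v
        (ℕ.suc i) _ u v → laterEdge k i u v
    }

  module PathSums (k : ℕ) (1≤width : 1 ≤ width) where
    R : ROABP F (ℕ.suc k) width r
    R = roabp k 1≤width

    partialEntry : ∀ j → .(j ℕ.< ℕ.suc k) → Vertex → Poly F (ℕ.suc k)
    partialEntry j j<ℓ (σ , a , b) = prefixProd (matPolyAt F (M σ)) j j<ℓ a b

    pathsTo-step : ∀ j (j<k : j ℕ.< k) (p : ℕ.suc j ℕ.< ℕ.suc k) v
                     (E : Vertex → Poly F (ℕ.suc k)) (edgeAt : Vertex → Maybe Coeffs) →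
                   (∀ u → pathsTo F R (ℕ.suc j) (ℕₚ.<⇒≤ p) u ≈ₚ E (decode (asInner k j j<k u))) →
                   (∀ u → laterEdge k j u v ≡ edgeAt (decode (asInner k j j<k u))) →
                   pathsTo F R (ℕ.suc (ℕ.suc j)) p v
                     ≈ₚ sumP F (λ w → E (decode w) *ₚ edgeLabel (Fin.fromℕ< p) (edgeAt (decode w)))
    pathsTo-step j j<k p v E edgeAt paths≈ edge≡ = begin
      sumP F (λ u → pathsTo F R (ℕ.suc j) (ℕₚ.<⇒≤ p) u *ₚ label F R (ℕ.suc j) p u v)
        ≈⟨ sumP-cong (λ u → *ₚ-cong {p = pathsTo F R (ℕ.suc j) (ℕₚ.<⇒≤ p) u} {E (vertex u)}
                                     {label F R (ℕ.suc j) p u v} {edgeLabel x (edgeAt (vertex u))}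
                                     (paths≈ u) (≡⇒≈ₚ (label≡ u))) ⟩
      sumP F (term ∘ asInner k j j<k)
        ≡⟨ sumP-asInner k j j<k term ⟩
      sumP F term
        ∎
      where
      open import Relation.Binary.Reasoning.Setoid (≈ₚ-setoid (ℕ.suc k))
      x : Fin (ℕ.suc k)
      x = Fin.fromℕ< p
      term : Fin width → Poly F (ℕ.suc k)
      term w = E (decode w) *ₚ edgeLabel x (edgeAt (decode w))
      vertex : Fin (innerWidth k j) → Vertex
      vertex = decode ∘ asInner k j j<k
      label≡ : ∀ u → label F R (ℕ.suc j) p u v ≡ edgeLabel x (edgeAt (vertex u))
      label≡ u = ≡.trans (label≡edgeLabel R (ℕ.suc j) p u v) (≡.cong (edgeLabel x) (edge≡ u))

    pathsTo-interior : ∀ j (j<k : j ℕ.< k) (p : ℕ.suc j ≤ ℕ.suc k) v →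
                       pathsTo F R (ℕ.suc j) p v ≈ₚ partialEntry j p (decode (asInner k j j<k v))
    pathsTo-interior ℕ.zero    (ℕ.s≤s _) p v m =
      trans (sumP-Fin1 (λ u → 1P F *ₚ label F R 0 p u v) m) (*ₚ-identityˡ (label F R 0 p zero v) m)
    pathsTo-interior (ℕ.suc j) 1+j<k     p v m =
      trans (pathsTo-step j j<k p v (partialEntry j (ℕₚ.<⇒≤ p)) (λ w → continueEdge w target)
                          (pathsTo-interior j j<k (ℕₚ.<⇒≤ p)) (λ u → laterEdge-continue k j j<k 1+j<k u v) m)
            (sumP-continueEdge (Fin.fromℕ< p) (partialEntry j (ℕₚ.<⇒≤ p))
                               (proj₁ target) (proj₁ (proj₂ target)) (proj₂ (proj₂ target)) m)
      where
      j<k : j ℕ.< k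
      j<k = ℕₚ.<⇒≤ 1+j<k
      target : Vertex
      target = decode (asInner k (ℕ.suc j) 1+j<k v)

  computes-depth1 : ∀ (1≤width : 1 ≤ width) →
                    computes F (roabp 0 1≤width) ≈ₚ sumP F (λ σ → α σ ·ₚ fTr F 1 (M σ))
  computes-depth1 1≤width = begin
    computes F R
      ≈⟨ sumP-Fin1 (pathsTo F R 1 ℕₚ.≤-refl) ⟩
    pathsTo F R 1 ℕₚ.≤-refl zero
      ≈⟨ sumP-Fin1 (λ u → 1P F *ₚ label F R 0 ℕₚ.≤-refl u zero) ⟩
    1P F *ₚ univ F zero (λ j → ∑[ σ ∈ allFin s ] (α σ * trM σ j))
      ≈⟨ *ₚ-identityˡ (univ F zero (λ j → ∑[ σ ∈ allFin s ] (α σ * trM σ j))) ⟩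
    univ F zero (λ j → ∑[ σ ∈ allFin s ] (α σ * trM σ j))
      ≈⟨ univ-sumOver zero (λ σ j → α σ * trM σ j) ⟩
    sumP F (λ σ → univ F zero (λ j → α σ * trM σ j))
      ≈⟨ sumP-cong (λ σ → ≡⇒≈ₚ (univ-·ₚ zero (α σ) (trM σ))) ⟩
    sumP F (λ σ → α σ ·ₚ univ F zero (trM σ))
      ≈⟨ sumP-cong (λ σ → ·ₚ-cong (α σ) {univ F zero (trM σ)} {trace F (matPolyAt F (M σ) zero)}
                                      (univ-sumOver zero (λ a j → M σ j a a))) ⟩
    sumP F (λ σ → α σ ·ₚ trace F (matPolyAt F (M σ) zero))
      ≈⟨ sumP-fTr≈trace-prefixProd 0 ⟨
    sumP F (λ σ → α σ ·ₚ fTr F 1 (M σ))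
      ∎
    where
    open import Relation.Binary.Reasoning.Setoid (≈ₚ-setoid 1)
    R : ROABP F 1 width r
    R = roabp 0 1≤width
    trM : Fin s → Coeffs
    trM σ j = ∑[ a ∈ allFin n ] M σ j a a

  computes-depth≥2 : ∀ k (1≤width : 1 ≤ width) →
                     computes F (roabp (ℕ.suc k) 1≤width)
                       ≈ₚ sumP F (λ σ → α σ ·ₚ fTr F (ℕ.suc (ℕ.suc k)) (M σ))
  computes-depth≥2 k 1≤width = sumP-sink k (pathsTo F R ℓ ℕₚ.≤-refl) {weightedTraces} λ t → begin
    pathsTo F R ℓ ℕₚ.≤-refl t
      ≈⟨ pathsTo-step k k<1+k ℕₚ.≤-refl t (partialEntry k k<ℓ) closeEdge
                      (pathsTo-interior k k<1+k k<ℓ) (λ u → laterEdge-close k k<1+k u t) ⟩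
    sumP F (λ w → partialEntry k k<ℓ (decode w) *ₚ edgeLabel x (closeEdge (decode w)))
      ≈⟨ sumP-closeEdge x (partialEntry k k<ℓ) ⟩
    sumP F (λ σ → α σ ·ₚ trace F (prefixProd (matPolyAt F (M σ)) (ℕ.suc k) ℕₚ.≤-refl))
      ≈⟨ sumP-fTr≈trace-prefixProd (ℕ.suc k) ⟨
    weightedTraces
      ∎
    where
    open PathSums (ℕ.suc k) 1≤width
    open import Relation.Binary.Reasoning.Setoid (≈ₚ-setoid (ℕ.suc (ℕ.suc k)))
    ℓ : ℕ
    ℓ = ℕ.suc (ℕ.suc k)
    k<1+k : k ℕ.< ℕ.suc k
    k<1+k = ℕₚ.n<1+n k
    k<ℓ : k ℕ.< ℓ
    k<ℓ = ℕₚ.<⇒≤ ℕₚ.≤-refl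
    x : Fin ℓ
    x = Fin.fromℕ< (ℕₚ.n<1+n (ℕ.suc k))
    weightedTraces : Poly F ℓ
    weightedTraces = sumP F (λ σ → α σ ·ₚ fTr F ℓ (M σ))

  traceCombination : ∀ k (1≤width : 1 ≤ width) →
                     computes F (roabp k 1≤width) ≈ₚ sumP F (λ σ → α σ ·ₚ fTr F (ℕ.suc k) (M σ))
  traceCombination ℕ.zero    = computes-depth1
  traceCombination (ℕ.suc k) = computes-depth≥2 k

open import Data.Nat using (_*_)

lemma3p2 : {c ℓ' : Level} (F : Field c ℓ') (n r ℓ : ℕ) → 1 ≤ n → 1 ≤ r → 1 ≤ ℓ →
           (A B : Fin r → Mat F n) →
           Σ (ROABP F ℓ (2 * (n * n)) r) λ R →
             _≈P_ F (computes F R) (_-P_ F (fTr F ℓ A) (fTr F ℓ B))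
lemma3p2 F n r ℕ.zero    _   _ () A B
lemma3p2 F n r (ℕ.suc k) 1≤n _ _ A B =
  roabp k 1≤width ,
  λ m → trans (traceCombination k 1≤width m) (sumP-sign (λ σ → fTr F (ℕ.suc k) (AB σ)) m)
  where
  open Field F using (trans)
  open Polynomials F using (sign; sumP-sign)
  AB : Fin 2 → Fin r → Mat F n
  AB zero    = A
  AB (suc _) = B
  open TraceCombination F AB sign using (roabp; traceCombination)
  1≤width : 1 ≤ 2 * (n * n)
  1≤width = ℕₚ.≤-trans (ℕₚ.*-mono-≤ 1≤n 1≤n) (ℕₚ.m≤m+n (n * n) _)
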